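{- Let $\varepsilon\in(0,1)$ with $1/\varepsilon\in\mathbb{Z}$, $T>0$, $L'\ge0$, and let $I_2$ be an instance of the splittable setup model in which all processing and setup times are positive multiples of $\varepsilon^2T$ and every setup time satisfies $\varepsilon T\le s_j\le T$. For each positive multiple $h$ of $\varepsilon^2T$ let $\tilde h=(1+\varepsilon)^{\lceil\log_{1+\varepsilon}(h/(\varepsilon^2T))\rceil}\varepsilon^2T$ and $\bar h=\lceil\tilde h/(\varepsilon^2T)\rceil\varepsilon^2T$, and let $\bar H=\{\bar h: h\in\varepsilon^2T\mathbb{Z}_{\ge1},\ h\le(1+2\varepsilon)^2T\}$. If there is a $((1+2\varepsilon)T,L')$-schedule for $I_2$ in which the length of each job part is a multiple of $\varepsilon^2T$, there is also an $\bar H$-structured $((1+2\varepsilon)^2T,L')$-schedule for $I_2$ with the same property.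
   Context: Splittable setup model: jobs with processing times and setup times $s_j$, $m$ identical machines. A schedule splits each job into finitely many parts (job pieces) with processing lengths summing to the job's processing time and assigns each part to a machine; in the ordinary case each piece $q$ of job $j$ contributes $s_j+q$ to its machine's load, the makespan is the maximum load, and a $(T',L')$-schedule has makespan at most $T'$ and free space $\sum_i(T'-\text{load}_i)\ge L'$. For a set $H^*$ of container sizes, an $H^*$-structured schedule is one in which each setup time together with its corresponding job piece (of length $q$) is packed into a container whose size is the smallest $h\in H^*$ with $s_j+q\le h$, and the load of a machine is the sum of the sizes of the containers on it.
   Formalization: The free-space bound $L'$ ranges only over nonnegative rationals, measured in units of $\varepsilon^2T$. -}

module Defs where

open import Data.Nat using (ℕ; zero; suc; _+_; _*_; _∸_; _^_; _≤_; _<_; _/_)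
open import Data.Fin using (Fin; zero; suc; _≟_)
open import Data.List using (List; []; _∷_; map)
open import Data.Nat.ListAction using (sum)
open import Data.List.Relation.Unary.All using (All)
open import Data.Product using (_×_; _,_; Σ; ∃)
open import Relation.Nullary using (does)
open import Data.Bool using (if_then_else_)
open import Relation.Binary.PropositionalEquality using (_≡_)
import Data.Integer as ℤ
import Data.Rational as ℚ

-- All times are measured in the unit δ = ε²T, where ε = 1/K (K = 1/ε ∈ ℤ).
-- Then T = K² units, εT = K units, (1+2ε)T = K²+2K units,
-- (1+2ε)²T = (K+2)² units, and 1+ε = (K+1)/K.

sumF : {m : ℕ} → (Fin m → ℕ) → ℕ
sumF {zero}  f = 0
sumF {suc m} f = f zero + sumF (λ i → f (suc i))

-- ceiling division ⌈a / (suc b)⌉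
ceilDiv : ℕ → ℕ → ℕ
ceilDiv a b = (a + b) / suc b

-- k = ⌈log_{1+ε} n⌉ : the least k with (1+ε)^k ≥ n, i.e. (K+1)^k ≥ n·K^k
IsCeilLog : (K n k : ℕ) → Set
IsCeilLog K n k =
  (n * K ^ k ≤ suc K ^ k) × (∀ k' → k' < k → suc K ^ k' < n * K ^ k')

-- hbar K n h : for the size n·δ, h̄ = h·δ where
-- h = ⌈(1+ε)^k⌉ = ⌈(K+1)^k / K^k⌉ with k = ⌈log_{1+ε} n⌉  (requires K ≥ 1)
Hbar : (K n h : ℕ) → Set
Hbar K n h = Σ ℕ λ k → IsCeilLog K n k × (h ≡ ceilDiv (suc K ^ k) (K ^ k ∸ 1))

InHbar : (K h : ℕ) → Set
InHbar K h = Σ ℕ λ n → (1 ≤ n) × (n ≤ (K + 2) * (K + 2)) × Hbar K n h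

IsContainer : (K x h : ℕ) → Set
IsContainer K x h = InHbar K h × (x ≤ h) × (∀ h' → InHbar K h' → x ≤ h' → h ≤ h')

-- A schedule of n jobs on m machines with all piece lengths multiples of δ:
-- each machine gets a finite list of job pieces (job, length in units of δ).
Piece : ℕ → Set
Piece n = Fin n × ℕ

Schedule : ℕ → ℕ → Set
Schedule m n = Fin m → List (Piece n)

pieceJob : {n : ℕ} → Piece n → Fin n
pieceJob (j , q) = j

pieceLen : {n : ℕ} → Piece n → ℕ
pieceLen (j , q) = q

amount : {n : ℕ} → Fin n → List (Piece n) → ℕ
amount j ps = sum (map (λ pc → if does (pieceJob pc ≟ j) then pieceLen pc else 0) ps)

Valid : {m n : ℕ} → (p : Fin n → ℕ) → Schedule m n → Set
Valid {m} {n} p σ =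
  (∀ i → All (λ pc → 1 ≤ pieceLen pc) (σ i)) × (∀ j → sumF (λ i → amount j (σ i)) ≡ p j)

load : {n : ℕ} → (s : Fin n → ℕ) → List (Piece n) → ℕ
load s ps = sum (map (λ pc → s (pieceJob pc) + pieceLen pc) ps)

-- free space ≥ L' (L' given in units of δ, a nonnegative rational)
FreeAtLeast : {m : ℕ} → (T' : ℕ) → (loads : Fin m → ℕ) → ℚ.ℚ → Set
FreeAtLeast T' loads L' = L' ℚ.≤ (ℤ.+ (sumF (λ i → T' ∸ loads i)) ℚ./ 1)

IsSchedule : {m n : ℕ} → (p s : Fin n → ℕ) → (T' : ℕ) → ℚ.ℚ → Schedule m n → Set
IsSchedule p s T' L' σ =
  Valid p σ × (∀ i → load s (σ i) ≤ T') × FreeAtLeast T' (λ i → load s (σ i)) L'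

-- H̄-structured: each piece comes with its container size, which must be the
-- smallest h ∈ H̄ with s_j + q ≤ h; machine load = sum of container sizes.
-- a structured piece: (job, length, container size)
SPiece : ℕ → Set
SPiece n = Fin n × ℕ × ℕ

SSchedule : ℕ → ℕ → Set
SSchedule m n = Fin m → List (SPiece n)

forget : {n : ℕ} → SPiece n → Piece n
forget (j , q , h) = (j , q)

underlying : {m n : ℕ} → SSchedule m n → Schedule m n
underlying τ i = map forget (τ i)

containerLoad : {n : ℕ} → List (SPiece n) → ℕ
containerLoad ps = sum (map (λ { (j , q , h) → h }) ps)

IsHbarStructSchedule : {m n : ℕ} → (K : ℕ) → (p s : Fin n → ℕ) → (T' : ℕ) → ℚ.ℚ → SSchedule m n → Set
IsHbarStructSchedule K p s T' L' τ =
  Valid p (underlying τ)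
  × (∀ i → All (λ { (j , q , h) → IsContainer K (s j + q) h }) (τ i))
  × (∀ i → containerLoad (τ i) ≤ T')
  × FreeAtLeast T' (λ i → containerLoad (τ i)) L'

-- A piece of total length x = s_j + q is at most the makespan, so it has a container: the
-- smallest h ∈ H̄ with x ≤ h exists because h̄(x) ≥ x lies in H̄. Minimality gives
-- h ≤ h̄(x) ≤ (1+ε)x + δ, and δ ≤ εx because x ≥ s_j ≥ εT; hence h ≤ (1+2ε)x. On every
-- machine the container load c and the old load l ≤ (1+2ε)T thus satisfy
-- c ≤ l + 2ε(1+2ε)T = l + ((1+2ε)²T − (1+2ε)T), so enlarging the makespan to (1+2ε)²T
-- loses no free space on any machine.
module Submission where

open import Defs
open import Data.Nat using (ℕ; _+_; _*_; _≤_)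
open import Data.Fin using (Fin)
open import Data.Product using (Σ; _×_)
import Data.Rational as ℚ

open import Data.Fin using (zero; suc)
open import Data.List using (List; []; _∷_; map)
open import Data.List.Relation.Unary.All using (All; []; _∷_)
open import Data.Nat
open import Data.Nat.Coprimality using (1-coprimeTo) renaming (sym to coprime-sym)
open import Data.Nat.DivMod using (m/n*n≤m; m*n/n≡m; /-monoˡ-≤)
open import Data.Nat.Properties
open import Data.Product using (∃; _,_; proj₁; proj₂)
open import Data.Sum using (inj₁; inj₂)
open import Function using (_∘_)
import Data.Integer as ℤ
import Data.Integer.Properties as ℤP
import Data.Rational.Properties as ℚP
open import Relation.Binary.PropositionalEquality
open import Data.Nat.Tactic.RingSolver using (solve-∀)
open import Algebra.Properties.CommutativeSemigroup *-commutativeSemigroup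
  using (x∙yz≈y∙xz; x∙yz≈z∙yx; xy∙z≈y∙xz)
open import Relation.Nullary using (¬_; Dec; yes; no)
open import Relation.Nullary.Decidable using (map′; _×-dec_)
open import Relation.Unary using (Decidable)

sumF-cong : ∀ {m} {f g : Fin m → ℕ} → (∀ i → f i ≡ g i) → sumF f ≡ sumF g
sumF-cong {zero}  _   = refl
sumF-cong {suc m} f≗g = cong₂ _+_ (f≗g zero) (sumF-cong (f≗g ∘ suc))

sumF-mono-≤ : ∀ {m} {f g : Fin m → ℕ} → (∀ i → f i ≤ g i) → sumF f ≤ sumF g
sumF-mono-≤ {zero}  _   = z≤n
sumF-mono-≤ {suc m} f≤g = +-mono-≤ (f≤g zero) (sumF-mono-≤ (f≤g ∘ suc))

+/1≡mkℚ : ∀ a → (ℤ.+ a ℚ./ 1) ≡ ℚ.mkℚ (ℤ.+ a) 0 (coprime-sym (1-coprimeTo a))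
+/1≡mkℚ a = ℚP.normalize-coprime (coprime-sym (1-coprimeTo a))

+/1-mono-≤ : ∀ {a b} → a ≤ b → (ℤ.+ a ℚ./ 1) ℚ.≤ (ℤ.+ b ℚ./ 1)
+/1-mono-≤ {a} {b} a≤b = subst₂ ℚ._≤_ (sym (+/1≡mkℚ a)) (sym (+/1≡mkℚ b))
  (ℚ.*≤* (ℤP.*-monoʳ-≤-nonNeg (ℤ.+ 1) (ℤ.+≤+ a≤b)))

FreeAtLeast-mono : ∀ {m} T T' (l l' : Fin m → ℕ) {L} →
  (∀ i → T ∸ l i ≤ T' ∸ l' i) → FreeAtLeast T l L → FreeAtLeast T' l' L
FreeAtLeast-mono _ _ _ _ free≤ free = ℚP.≤-trans free (+/1-mono-≤ (sumF-mono-≤ free≤))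

Valid-cong : ∀ {m n} {p : Fin n → ℕ} {σ σ' : Schedule m n} →
  (∀ i → σ i ≡ σ' i) → Valid p σ → Valid p σ'
Valid-cong σ≗σ' (lengths , amounts) =
    (λ i → subst (All (λ pc → 1 ≤ pieceLen pc)) (σ≗σ' i) (lengths i))
  , (λ j → trans (sumF-cong (λ i → cong (amount j) (sym (σ≗σ' i)))) (amounts j))

IsLeast : (ℕ → Set) → ℕ → Set
IsLeast P k = P k × (∀ {k'} → k' < k → ¬ P k')

least : {P : ℕ → Set} → Decidable P → ∀ {b} → P b → ∃ (IsLeast P)
least {P} P? {b} pb = search b 0 (λ ()) (subst P (sym (+-identityʳ b)) pb)
  where
  search : ∀ d k → (∀ {k'} → k' < k → ¬ P k') → P (d + k) → ∃ (IsLeast P)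
  search zero    k below pk = k , pk , below
  search (suc d) k below pd+k with P? k
  ... | yes pk = k , pk , below
  ... | no ¬pk = search d (suc k) below′ (subst P (sym (+-suc d k)) pd+k)
    where
    below′ : ∀ {k'} → k' < suc k → ¬ P k'
    below′ k'<1+k with m≤n⇒m<n∨m≡n (s≤s⁻¹ k'<1+k)
    ... | inj₁ k'<k = below k'<k
    ... | inj₂ refl = ¬pk

bounded-∃? : {P : ℕ → Set} → Decidable P → ∀ N → Dec (Σ ℕ λ n → 1 ≤ n × n ≤ N × P n)
bounded-∃? P? zero = no λ { (n , 1≤n , n≤0 , _) → <⇒≱ 1≤n n≤0 }
bounded-∃? {P} P? (suc N) with P? (suc N) | bounded-∃? P? N
... | yes p | _ = yes (suc N , s≤s z≤n , ≤-refl , p)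
... | no _  | yes (n , 1≤n , n≤N , pn) = yes (n , 1≤n , m≤n⇒m≤1+n n≤N , pn)
... | no ¬p | no ¬∃ = no λ { (n , 1≤n , n≤1+N , pn) → excluded 1≤n n≤1+N pn }
  where
  excluded : ∀ {n} → 1 ≤ n → n ≤ suc N → ¬ P n
  excluded {n} 1≤n n≤1+N pn with m≤n⇒m<n∨m≡n n≤1+N
  ... | inj₁ n<1+N = ¬∃ (n , 1≤n , s≤s⁻¹ n<1+N , pn)
  ... | inj₂ refl  = ¬p pn

≤-ceilDiv : ∀ {x a b} → 0 < b → x * b ≤ a → x ≤ ceilDiv a (b ∸ 1)
≤-ceilDiv {x} {a} {suc d} _ x*b≤a = begin
  x                  ≡⟨ sym (m*n/n≡m x (suc d)) ⟩
  x * suc d / suc d  ≤⟨ /-monoˡ-≤ (suc d) (≤-trans x*b≤a (m≤m+n a d)) ⟩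
  (a + d) / suc d    ∎
  where open ≤-Reasoning

ceilDiv-*-< : ∀ {a b} → 0 < b → ceilDiv a (b ∸ 1) * b < a + b
ceilDiv-*-< {a} {suc d} _ = begin-strict
  ceilDiv a d * suc d  ≤⟨ m/n*n≤m (a + d) (suc d) ⟩
  a + d                <⟨ +-monoʳ-< a (n<1+n d) ⟩
  a + suc d            ∎
  where open ≤-Reasoning

+-mono-≤-scaled : ∀ {a b x x' y y'} → a * x ≤ b * y → a * x' ≤ b * y' → a * (x + x') ≤ b * (y + y')
+-mono-≤-scaled {a} {b} {x} {x'} {y} {y'} ax≤by ax'≤by' = begin
  a * (x + x')   ≡⟨ *-distribˡ-+ a x x' ⟩
  a * x + a * x' ≤⟨ +-mono-≤ ax≤by ax'≤by' ⟩
  b * y + b * y' ≡⟨ *-distribˡ-+ b y y' ⟨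
  b * (y + y')   ∎
  where open ≤-Reasoning

*-cancelˡ-≤-+ : ∀ K .{{_ : NonZero K}} {a b c l} → K * c ≤ (a + K) * l → l ≤ K * b → c ≤ a * b + l
*-cancelˡ-≤-+ K {a} {b} {c} {l} Kc≤[a+K]l l≤Kb = *-cancelˡ-≤ K (begin
  K * c              ≤⟨ Kc≤[a+K]l ⟩
  (a + K) * l        ≡⟨ *-distribʳ-+ l a K ⟩
  a * l + K * l      ≤⟨ +-monoˡ-≤ (K * l) (*-monoʳ-≤ a l≤Kb) ⟩
  a * (K * b) + K * l ≡⟨ cong (_+ K * l) (x∙yz≈y∙xz a K b) ⟩
  K * (a * b) + K * l ≡⟨ *-distribˡ-+ K (a * b) l ⟨
  K * (a * b + l)    ∎)
  where open ≤-Reasoning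

∸-shift : ∀ {c d l} T → c ≤ d + l → T ∸ l ≤ (d + T) ∸ c
∸-shift {c} {d} {l} T c≤d+l = begin
  T ∸ l              ≡⟨ [m+n]∸[m+o]≡n∸o d T l ⟨
  (d + T) ∸ (d + l)  ≤⟨ ∸-monoʳ-≤ (d + T) c≤d+l ⟩
  (d + T) ∸ c        ∎
  where open ≤-Reasoning

bernoulli : ∀ K j → K ^ j * (K + j) ≤ K * suc K ^ j
bernoulli K zero    = ≤-reflexive (trans (*-identityˡ (K + 0)) (trans (+-identityʳ K) (sym (*-identityʳ K))))
bernoulli K (suc j) = begin
  K * K ^ j * (K + suc j)    ≡⟨ xy∙z≈y∙xz K (K ^ j) (K + suc j) ⟩
  K ^ j * (K * (K + suc j))  ≤⟨ *-monoʳ-≤ (K ^ j) step ⟩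
  K ^ j * (suc K * (K + j))  ≡⟨ x∙yz≈y∙xz (K ^ j) (suc K) (K + j) ⟩
  suc K * (K ^ j * (K + j))  ≤⟨ *-monoʳ-≤ (suc K) (bernoulli K j) ⟩
  suc K * (K * suc K ^ j)    ≡⟨ x∙yz≈y∙xz (suc K) K (suc K ^ j) ⟩
  K * (suc K * suc K ^ j)    ∎
  where
  open ≤-Reasoning
  step : K * (K + suc j) ≤ suc K * (K + j)
  step = begin
    K * (K + suc j)      ≡⟨ cong (K *_) (+-suc K j) ⟩
    K * suc (K + j)      ≡⟨ *-suc K (K + j) ⟩
    K + K * (K + j)      ≤⟨ +-monoˡ-≤ (K * (K + j)) (m≤m+n K j) ⟩
    K + j + K * (K + j)  ∎

module Containers (K : ℕ) .{{_ : NonZero K}} where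

  T₁ T₂ : ℕ
  T₁ = K * K + 2 * K
  T₂ = (K + 2) * (K + 2)

  T₁≡K*[2+K] : T₁ ≡ K * (2 + K)
  T₁≡K*[2+K] = identity K
    where
    identity : ∀ k → k * k + 2 * k ≡ k * (2 + k)
    identity = solve-∀

  T₂≡2*[2+K]+T₁ : T₂ ≡ 2 * (2 + K) + T₁
  T₂≡2*[2+K]+T₁ = identity K
    where
    identity : ∀ k → (k + 2) * (k + 2) ≡ 2 * (2 + k) + (k * k + 2 * k)
    identity = solve-∀

  T₁≤T₂ : T₁ ≤ T₂
  T₁≤T₂ = subst (T₁ ≤_) (sym T₂≡2*[2+K]+T₁) (m≤n+m T₁ (2 * (2 + K)))

  ceilLog-witness : ∀ n → n * K ^ (n * K) ≤ suc K ^ (n * K)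
  ceilLog-witness n = *-cancelˡ-≤ K (begin
    K * (n * K ^ (n * K))      ≡⟨ x∙yz≈z∙yx K n (K ^ (n * K)) ⟩
    K ^ (n * K) * (n * K)      ≤⟨ *-monoʳ-≤ (K ^ (n * K)) (m≤n+m (n * K) K) ⟩
    K ^ (n * K) * (K + n * K)  ≤⟨ bernoulli K (n * K) ⟩
    K * suc K ^ (n * K)        ∎)
    where open ≤-Reasoning

  ceilLog : ∀ n → ∃ (IsCeilLog K n)
  ceilLog n with least (λ k → n * K ^ k ≤? suc K ^ k) {n * K} (ceilLog-witness n)
  ... | k , fits , below = k , fits , λ k' k'<k → ≰⇒> (below k'<k)

  ceilLog-unique : ∀ {n k k'} → IsCeilLog K n k → IsCeilLog K n k' → k ≡ k'
  ceilLog-unique (fits , below) (fits' , below') = ≤-antisym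
    (≮⇒≥ λ k'<k → <⇒≱ (below _ k'<k) fits')
    (≮⇒≥ λ k<k' → <⇒≱ (below' _ k<k') fits)

  ceilPow : ℕ → ℕ
  ceilPow k = ceilDiv (suc K ^ k) (K ^ k ∸ 1)

  hbar : ℕ → ℕ
  hbar n = ceilPow (proj₁ (ceilLog n))

  hbar-Hbar : ∀ n → Hbar K n (hbar n)
  hbar-Hbar n = proj₁ (ceilLog n) , proj₂ (ceilLog n) , refl

  Hbar⇒≡hbar : ∀ {n h} → Hbar K n h → h ≡ hbar n
  Hbar⇒≡hbar {n} (k , isLog , refl) = cong ceilPow (ceilLog-unique {n} isLog (proj₂ (ceilLog n)))

  Hbar? : ∀ n h → Dec (Hbar K n h)
  Hbar? n h = map′ (λ { refl → hbar-Hbar n }) (Hbar⇒≡hbar {n}) (h ≟ hbar n)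

  InHbar? : Decidable (InHbar K)
  InHbar? h = bounded-∃? (λ n → Hbar? n h) T₂

  hbar-InHbar : ∀ {x} → 1 ≤ x → x ≤ T₂ → InHbar K (hbar x)
  hbar-InHbar {x} 1≤x x≤T₂ = x , 1≤x , x≤T₂ , hbar-Hbar x

  ≤-hbar : ∀ x → x ≤ hbar x
  ≤-hbar x = ≤-ceilDiv {x} (m^n>0 K (proj₁ (ceilLog x))) (proj₁ (proj₂ (ceilLog x)))

  ceilPow-bound : ∀ {x k} → IsCeilLog K x k → K * ceilPow k ≤ suc K * x + K
  ceilPow-bound {x} {zero}  _ = ≤-trans (≤-reflexive (*-identityʳ K)) (m≤n+m K (suc K * x))
  ceilPow-bound {x} {suc k} (_ , below) = <⇒≤ (*-cancelʳ-< (K ^ k) (K * h) (suc K * x + K) (begin-strict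
    K * h * K ^ k                    ≡⟨ xy∙z≈y∙xz K h (K ^ k) ⟩
    h * (K * K ^ k)                  <⟨ ceilDiv-*-< (m^n>0 K (suc k)) ⟩
    suc K * suc K ^ k + K * K ^ k    ≤⟨ +-monoˡ-≤ (K * K ^ k) (*-monoʳ-≤ (suc K) (<⇒≤ (below k ≤-refl))) ⟩
    suc K * (x * K ^ k) + K * K ^ k  ≡⟨ cong (_+ K * K ^ k) (sym (*-assoc (suc K) x (K ^ k))) ⟩
    suc K * x * K ^ k + K * K ^ k    ≡⟨ sym (*-distribʳ-+ (K ^ k) (suc K * x) K) ⟩
    (suc K * x + K) * K ^ k          ∎))
    where
    open ≤-Reasoning
    h = ceilPow (suc k)

  hbar-bound : ∀ x → K * hbar x ≤ suc K * x + K
  hbar-bound x = ceilPow-bound {x} (proj₂ (ceilLog x))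

  container : ∀ {x} → 1 ≤ x → x ≤ T₂ → ∃ (IsContainer K x)
  container {x} 1≤x x≤T₂
    with least (λ h → InHbar? h ×-dec x ≤? h) {hbar x} (hbar-InHbar 1≤x x≤T₂ , ≤-hbar x)
  ... | h , (h∈H̄ , x≤h) , below =
    h , h∈H̄ , x≤h , λ h' h'∈H̄ x≤h' → ≮⇒≥ λ h'<h → below h'<h (h'∈H̄ , x≤h')

  container-bound : ∀ {x h} → K ≤ x → x ≤ T₂ → IsContainer K x h → K * h ≤ (2 + K) * x
  container-bound {x} {h} K≤x x≤T₂ (_ , _ , minimal) = begin
    K * h          ≤⟨ *-monoʳ-≤ K (minimal (hbar x) (hbar-InHbar 1≤x x≤T₂) (≤-hbar x)) ⟩
    K * hbar x     ≤⟨ hbar-bound x ⟩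
    suc K * x + K  ≤⟨ +-monoʳ-≤ (suc K * x) K≤x ⟩
    suc K * x + x  ≡⟨ +-comm (suc K * x) x ⟩
    (2 + K) * x    ∎
    where
    open ≤-Reasoning
    1≤x : 1 ≤ x
    1≤x = ≤-trans (>-nonZero⁻¹ K) K≤x

  FitsContainer : ∀ {n} → (Fin n → ℕ) → SPiece n → Set
  FitsContainer s (j , q , h) = IsContainer K (s j + q) h

  record Containerised {n} (s : Fin n → ℕ) (ps : List (Piece n)) : Set where
    field
      pieces      : List (SPiece n)
      forget-≡    : map forget pieces ≡ ps
      fit         : All (FitsContainer s) pieces
      load-bound  : K * containerLoad pieces ≤ (2 + K) * load s ps

  containerise : ∀ {n} (s : Fin n → ℕ) → (∀ j → K ≤ s j) →
    (ps : List (Piece n)) → load s ps ≤ T₂ → Containerised s ps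
  containerise s s≥K [] _ = record { pieces = [] ; forget-≡ = refl ; fit = [] ; load-bound = ≤-refl }
  containerise s s≥K ((j , q) ∷ ps) load≤T₂ = record
    { pieces     = (j , q , h) ∷ pieces
    ; forget-≡   = cong ((j , q) ∷_) forget-≡
    ; fit        = x-fits ∷ fit
    ; load-bound = +-mono-≤-scaled {K} {2 + K} {y = x} {y' = load s ps} (container-bound K≤x x≤T₂ x-fits) load-bound
    }
    where
    x : ℕ
    x = s j + q
    K≤x : K ≤ x
    K≤x = ≤-trans (s≥K j) (m≤m+n (s j) q)
    x≤T₂ : x ≤ T₂
    x≤T₂ = ≤-trans (m≤m+n x (load s ps)) load≤T₂
    x-container : ∃ (IsContainer K x)
    x-container = container (≤-trans (>-nonZero⁻¹ K) K≤x) x≤T₂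
    h : ℕ
    h = proj₁ x-container
    x-fits : IsContainer K x h
    x-fits = proj₂ x-container
    open Containerised (containerise s s≥K ps (≤-trans (m≤n+m (load s ps) x) load≤T₂))

  machine-bounds : ∀ {c l} → K * c ≤ (2 + K) * l → l ≤ T₁ → c ≤ T₂ × T₁ ∸ l ≤ T₂ ∸ c
  machine-bounds {c} {l} Kc≤[2+K]l l≤T₁ =
      subst (c ≤_) (sym T₂≡2*[2+K]+T₁) (≤-trans c≤ (+-monoʳ-≤ (2 * (2 + K)) l≤T₁))
    , subst (λ t → T₁ ∸ l ≤ t ∸ c) (sym T₂≡2*[2+K]+T₁) (∸-shift {c} {2 * (2 + K)} {l} T₁ c≤)
    where
    c≤ : c ≤ 2 * (2 + K) + l
    c≤ = *-cancelˡ-≤-+ K {2} {2 + K} Kc≤[2+K]l (subst (l ≤_) T₁≡K*[2+K] l≤T₁)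

lemma22 : (K : ℕ) → 2 ≤ K → (m n : ℕ) → (p s : Fin n → ℕ) → (L' : ℚ.ℚ) → ℚ.0ℚ ℚ.≤ L'
    → (∀ j → 1 ≤ p j) → (∀ j → K ≤ s j × s j ≤ K * K)
    → Σ (Schedule m n) (IsSchedule p s (K * K + 2 * K) L')
    → Σ (SSchedule m n) (IsHbarStructSchedule K p s ((K + 2) * (K + 2)) L')
lemma22 K@(suc _) (s≤s _) m n p s L' _ _ s-bounds (σ , valid , load≤T₁ , free) =
  τ , Valid-cong (sym ∘ forget-≡ ∘ containerised) valid , fit ∘ containerised , (proj₁ ∘ bounds) , free₂
  where
  open Containers K
  open Containerised
  containerised : ∀ i → Containerised s (σ i)
  containerised i = containerise s (proj₁ ∘ s-bounds) (σ i) (≤-trans (load≤T₁ i) T₁≤T₂)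
  τ : SSchedule m n
  τ = pieces ∘ containerised
  bounds : ∀ i → containerLoad (τ i) ≤ T₂ × T₁ ∸ load s (σ i) ≤ T₂ ∸ containerLoad (τ i)
  bounds i = machine-bounds (load-bound (containerised i)) (load≤T₁ i)
  free₂ : FreeAtLeast T₂ (containerLoad ∘ τ) L'
  free₂ = FreeAtLeast-mono T₁ T₂ (load s ∘ σ) (containerLoad ∘ τ) (proj₂ ∘ bounds) free
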